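{- Call a finite bitstring multus if each of its $1$s has at least one neighboring (adjacent) $1$. Let $f_0=0$, $f_1=f_2=1$, $f_k=2f_{k-1}-f_{k-2}+f_{k-3}$, so that there are $f_{n+2}$ multus bitstrings of length $n$. For a bitstring chosen uniformly at random among the multus bitstrings of length $n$, let $R_{n,0}$ be the length of its longest run of consecutive $0$s ($0$ if it has no $0$). Then for every $n\ge 0$, $$\mathbb{E}(R_{n,0})=\frac{1}{f_{n+2}}[z^n]\sum_{k=1}^{\infty}\left(\frac{1+z^2}{1-2z+z^2-z^3}-\frac{1+z^2-z^{k-1}+z^k-2z^{k+1}}{1-2z+z^2-z^3+z^{k+2}}\right)z,$$ where $[z^n]$ denotes the coefficient of $z^n$ in the formal power series expansion. -}

module Defs where

open import Data.Bool using (Bool; true; false)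
open import Data.Nat as ℕ using (ℕ; zero; suc; _⊔_)
open import Data.Integer as ℤ using (ℤ; +_; -[1+_]; _+_; _*_; _-_; -_)
open import Data.Rational as ℚ using (ℚ; 0ℚ)
open import Data.Fin using (Fin; toℕ)
open import Data.Vec using (Vec; lookup; toList)
open import Data.List using (List; []; _∷_; map; length)
open import Data.Nat.ListAction using (sum)
open import Data.Product using (∃-syntax; _×_)
open import Data.Sum using (_⊎_)
open import Relation.Binary.PropositionalEquality using (_≡_)
open import Relation.Nullary using (yes; no)

-- Bitstrings: Vec Bool n, with true = 1 and false = 0.

Adjacent : {n : ℕ} → Fin n → Fin n → Set
Adjacent i j = suc (toℕ i) ≡ toℕ j ⊎ suc (toℕ j) ≡ toℕ i

Multus : {n : ℕ} → Vec Bool n → Set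
Multus {n} v = (i : Fin n) → lookup v i ≡ true →
  ∃[ j ] (Adjacent i j × lookup v j ≡ true)

-- longest run of consecutive 0s (0 if there is no 0);
-- cur = length of the current run of 0s, best = longest finished run
longestZeroRunAux : ℕ → ℕ → List Bool → ℕ
longestZeroRunAux cur best [] = best ⊔ cur
longestZeroRunAux cur best (false ∷ bs) = longestZeroRunAux (suc cur) best bs
longestZeroRunAux cur best (true ∷ bs) = longestZeroRunAux 0 (best ⊔ cur) bs

R₀ : {n : ℕ} → Vec Bool n → ℕ
R₀ v = longestZeroRunAux 0 0 (toList v)

f : ℕ → ℤ
f 0 = + 0
f 1 = + 1
f 2 = + 1
f (suc (suc (suc k))) = + 2 * f (suc (suc k)) - f (suc k) + f k

-- Rational division p / q  (convention: value 0 when q = 0; only ever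
-- used with nonzero denominators)

_÷ℤ_ : ℤ → ℤ → ℚ
p ÷ℤ (+ zero) = 0ℚ
p ÷ℤ (+ suc m) = p ℚ./ suc m
p ÷ℤ (-[1+ m ]) = (- p) ℚ./ suc m

-- Expectation of R₀ under the uniform distribution on a finite list of
-- (distinct) bitstrings

expectR₀ : {n : ℕ} → List (Vec Bool n) → ℚ
expectR₀ L = (+ sum (map R₀ L)) ÷ℤ (+ length L)

Series : Set
Series = ℕ → ℤ

mono : ℤ → ℕ → Series
mono c e i with i ℕ.≟ e
... | yes _ = c
... | no _ = + 0

infixl 6 _⊕_ _⊖_
_⊕_ : Series → Series → Series
(s ⊕ t) i = s i + t i

_⊖_ : Series → Series → Series
(s ⊖ t) i = s i - t i

shiftZ : Series → Series
shiftZ s zero = + 0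
shiftZ s (suc i) = s i

-- Power series division P / Q for Q with constant coefficient 1:
-- S = P/Q is the unique series with Q·S = P, i.e.
-- s_m = p_m - Σ_{i=1}^{m} q_i s_{m-i}.
-- divList P Q m = [s_m, s_{m-1}, ..., s_0].
dotQ : Series → List ℤ → ℕ → ℤ
dotQ Q [] i = + 0
dotQ Q (r ∷ rs) i = Q i * r + dotQ Q rs (suc i)

divList : Series → Series → ℕ → List ℤ
divList P Q zero = P 0 ∷ []
divList P Q (suc m) = (P (suc m) - dotQ Q rs 1) ∷ rs
  where rs = divList P Q m

headℤ : List ℤ → ℤ
headℤ [] = + 0
headℤ (x ∷ _) = x

_⊘_ : Series → Series → Series
(P ⊘ Q) m = headℤ (divList P Q m)

Afun : Series
Afun = (mono (+ 1) 0 ⊕ mono (+ 1) 2)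
     ⊘ (mono (+ 1) 0 ⊖ mono (+ 2) 1 ⊕ mono (+ 1) 2 ⊖ mono (+ 1) 3)

Bfun : ℕ → Series
Bfun k = (mono (+ 1) 0 ⊕ mono (+ 1) 2 ⊖ mono (+ 1) (k ℕ.∸ 1)
           ⊕ mono (+ 1) k ⊖ mono (+ 2) (suc k))
       ⊘ (mono (+ 1) 0 ⊖ mono (+ 2) 1 ⊕ mono (+ 1) 2 ⊖ mono (+ 1) 3
           ⊕ mono (+ 1) (suc (suc k)))

term : ℕ → Series
term k = shiftZ (Afun ⊖ Bfun k)

partialSum : ℕ → Series
partialSum zero = λ _ → + 0
partialSum (suc N) = partialSum N ⊕ term (suc N)

module Submission where

-- Write M_n for the multus words of length n and A, B_k for the
-- series of the theorem.  We show that [z^m] A = |M_{m+1}| and that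
-- [z^m] B_k = #{w ∈ M_{m+1} : R₀ w < k}; then, for N ≥ n, the layer-cake
-- formula R = Σ_{k=1}^{N} [R ≥ k] turns [z^n] Σ_{k ≤ N} (A - B_k) z into
-- Σ_{w ∈ M_n} R₀ w, while f (n+2) = |M_n|.

open import Defs
open import Data.Bool using (Bool; true; false; _∧_; if_then_else_)
open import Data.Bool.Properties using (∧-assoc; ∧-zeroʳ; ∧-identityʳ; T-≡)
open import Data.Empty using (⊥; ⊥-elim)
open import Data.Fin using (Fin) renaming (zero to fzero; suc to fsuc)
open import Data.Integer as ℤ using (ℤ; +_; _+_; _*_; _-_)
import Data.Integer.Properties as ℤP
open import Data.Integer.Tactic.RingSolver using (solve-∀)
open import Data.List using (List; []; _∷_; map; length)
open import Data.List.Membership.Propositional using (_∈_; _∉_)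
import Data.List.Relation.Unary.All as All
open import Data.List.Relation.Unary.AllPairs using (_∷_)
open import Data.List.Relation.Unary.Any using (here; there)
open import Data.List.Relation.Unary.Unique.Propositional using (Unique)
open import Data.Nat as ℕ using (ℕ; zero; suc; z≤n; s≤s; _≤_; _<_; _<ᵇ_; _⊔_; _⊓_)
open import Data.Nat.ListAction using (sum)
import Data.Nat.Properties as ℕP
open import Algebra.Properties.CommutativeSemigroup ℕP.+-commutativeSemigroup
  using () renaming (interchange to +-interchange)
open import Data.Product using (∃-syntax; _×_; _,_)
open import Data.Sum using (_⊎_; inj₁; inj₂)
open import Data.Vec using (Vec; []; _∷_; lookup; toList)
import Data.Vec.Properties as Vec
open import Function using (_∘_)
open import Function.Bundles using (_⇔_; Equivalence)
open import Relation.Binary.PropositionalEquality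
open import Relation.Nullary using (yes; no)
open ≡-Reasoning

zpow : ℕ → Series
zpow zero    zero    = + 1
zpow zero    (suc m) = + 0
zpow (suc e) zero    = + 0
zpow (suc e) (suc m) = zpow e m

zpow-below : ∀ e m → m < e → zpow e m ≡ + 0
zpow-below (suc e) zero    _         = refl
zpow-below (suc e) (suc m) (s≤s m<e) = zpow-below e m m<e

mono-zpow : ∀ c e m → mono c e m ≡ c * zpow e m
mono-zpow c e m with m ℕ.≟ e
... | yes refl = sym (trans (cong (c *_) (zpow-diagonal e)) (ℤP.*-identityʳ c))
  where
  zpow-diagonal : ∀ e → zpow e e ≡ + 1
  zpow-diagonal zero    = refl
  zpow-diagonal (suc e) = zpow-diagonal e
... | no m≢e = sym (trans (cong (c *_) (zpow-off m≢e)) (ℤP.*-zeroʳ c))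
  where
  zpow-off : ∀ {e m} → m ≢ e → zpow e m ≡ + 0
  zpow-off {zero}  {zero}  m≢e = ⊥-elim (m≢e refl)
  zpow-off {zero}  {suc m} _   = refl
  zpow-off {suc e} {zero}  _   = refl
  zpow-off {suc e} {suc m} m≢e = zpow-off (m≢e ∘ cong suc)

shift : ℕ → Series → Series
shift zero    X m       = X m
shift (suc j) X zero    = + 0
shift (suc j) X (suc m) = shift j X m

down : Series → Series
down X m = X (suc m)

shift-cong : ∀ {X Y} j → (∀ i → X i ≡ Y i) → ∀ m → shift j X m ≡ shift j Y m
shift-cong zero    eq m       = eq m
shift-cong (suc j) eq zero    = refl
shift-cong (suc j) eq (suc m) = shift-cong j eq m

shift-shift : ∀ X j m → shift 1 (shift j X) m ≡ shift (suc j) X m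
shift-shift X j zero    = refl
shift-shift X j (suc m) = refl

shift-⊕ : ∀ X Y j m → shift j (X ⊕ Y) m ≡ shift j X m + shift j Y m
shift-⊕ X Y zero    m       = refl
shift-⊕ X Y (suc j) zero    = refl
shift-⊕ X Y (suc j) (suc m) = shift-⊕ X Y j m

shift-⊖ : ∀ X Y j m → shift j (X ⊖ Y) m ≡ shift j X m - shift j Y m
shift-⊖ X Y zero    m       = refl
shift-⊖ X Y (suc j) zero    = refl
shift-⊖ X Y (suc j) (suc m) = shift-⊖ X Y j m

shift-zpow : ∀ j e m → shift j (zpow e) m ≡ zpow (j ℕ.+ e) m
shift-zpow zero    e m       = refl
shift-zpow (suc j) e zero    = refl
shift-zpow (suc j) e (suc m) = shift-zpow j e m

shift-null : ∀ {X} j → (∀ i → X i ≡ + 0) → ∀ m → shift j X m ≡ + 0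
shift-null zero    eq m       = eq m
shift-null (suc j) eq zero    = refl
shift-null (suc j) eq (suc m) = shift-null j eq m

shift-below : ∀ X j m → m < j → shift j X m ≡ + 0
shift-below X (suc j) zero    _         = refl
shift-below X (suc j) (suc m) (s≤s m<j) = shift-below X j m m<j

difference-injective : ∀ X Y → (∀ m → X m - shift 1 X m ≡ Y m - shift 1 Y m) →
  ∀ m → X m ≡ Y m
difference-injective X Y eq zero    =
  trans (sym (ℤP.+-identityʳ _)) (trans (eq 0) (ℤP.+-identityʳ _))
difference-injective X Y eq (suc m) = begin
  X (suc m)             ≡⟨ undo (X (suc m)) (X m) ⟩
  X (suc m) - X m + X m ≡⟨ cong₂ _+_ (eq (suc m)) (difference-injective X Y eq m) ⟩
  Y (suc m) - Y m + Y m ≡⟨ sym (undo (Y (suc m)) (Y m)) ⟩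
  Y (suc m)             ∎
  where
  undo : ∀ a b → a ≡ a - b + b
  undo = solve-∀

coeffs : Series → ℕ → List ℤ
coeffs X zero    = X 0 ∷ []
coeffs X (suc m) = X (suc m) ∷ coeffs X m

coeffs-cong : ∀ {X Y} m → (∀ i → i ≤ m → X i ≡ Y i) → coeffs X m ≡ coeffs Y m
coeffs-cong zero    eq = cong (_∷ []) (eq 0 z≤n)
coeffs-cong (suc m) eq =
  cong₂ _∷_ (eq (suc m) ℕP.≤-refl) (coeffs-cong m (λ i i≤m → eq i (ℕP.m≤n⇒m≤1+n i≤m)))

-- The Cauchy product: (Q ⊛ X) m = Σ_{i ≤ m} Q i · X (m - i).
infixl 7 _⊛_
_⊛_ : Series → Series → Series
(Q ⊛ X) m = dotQ Q (coeffs X m) 0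

dotQ-down : ∀ Q rs i → dotQ Q rs (suc i) ≡ dotQ (down Q) rs i
dotQ-down Q []       i = refl
dotQ-down Q (r ∷ rs) i = cong (λ t → Q (suc i) * r + t) (dotQ-down Q rs (suc i))

⊛-zero : ∀ Q X → (Q ⊛ X) 0 ≡ Q 0 * X 0
⊛-zero Q X = ℤP.+-identityʳ _

⊛-suc : ∀ Q X m → (Q ⊛ X) (suc m) ≡ Q 0 * X (suc m) + (down Q ⊛ X) m
⊛-suc Q X m = cong (λ t → Q 0 * X (suc m) + t) (dotQ-down Q (coeffs X m) 0)

⊛-congˡ : ∀ {Q Q'} X → (∀ i → Q i ≡ Q' i) → ∀ m → (Q ⊛ X) m ≡ (Q' ⊛ X) m
⊛-congˡ {Q} {Q'} X eq zero    =
  trans (⊛-zero Q X) (trans (cong (_* X 0) (eq 0)) (sym (⊛-zero Q' X)))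
⊛-congˡ {Q} {Q'} X eq (suc m) = begin
  (Q ⊛ X) (suc m)                     ≡⟨ ⊛-suc Q X m ⟩
  Q 0 * X (suc m) + (down Q ⊛ X) m    ≡⟨ cong₂ _+_ (cong (_* X (suc m)) (eq 0))
                                                   (⊛-congˡ X (eq ∘ suc) m) ⟩
  Q' 0 * X (suc m) + (down Q' ⊛ X) m  ≡⟨ sym (⊛-suc Q' X m) ⟩
  (Q' ⊛ X) (suc m)                    ∎

⊛-congʳ : ∀ Q {X Y} m → (∀ i → i ≤ m → X i ≡ Y i) → (Q ⊛ X) m ≡ (Q ⊛ Y) m
⊛-congʳ Q m eq = cong (λ rs → dotQ Q rs 0) (coeffs-cong m eq)

⊛-nullˡ : ∀ {Q} X → (∀ i → Q i ≡ + 0) → ∀ m → (Q ⊛ X) m ≡ + 0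
⊛-nullˡ {Q} X eq zero    = trans (⊛-zero Q X) (trans (cong (_* X 0) (eq 0)) (ℤP.*-zeroˡ (X 0)))
⊛-nullˡ {Q} X eq (suc m) = begin
  (Q ⊛ X) (suc m)                   ≡⟨ ⊛-suc Q X m ⟩
  Q 0 * X (suc m) + (down Q ⊛ X) m  ≡⟨ cong₂ _+_ (trans (cong (_* X (suc m)) (eq 0)) (ℤP.*-zeroˡ (X (suc m))))
                                                 (⊛-nullˡ X (eq ∘ suc) m) ⟩
  + 0                               ∎

⊛-mono : ∀ c e X m → (mono c e ⊛ X) m ≡ c * shift e X m
⊛-mono c zero    X zero    = ⊛-zero (mono c 0) X
⊛-mono c zero    X (suc m) = begin
  (mono c 0 ⊛ X) (suc m)                       ≡⟨ ⊛-suc (mono c 0) X m ⟩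
  c * X (suc m) + (down (mono c 0) ⊛ X) m      ≡⟨ cong (λ t → c * X (suc m) + t) (⊛-nullˡ X (λ _ → refl) m) ⟩
  c * X (suc m) + + 0                          ≡⟨ ℤP.+-identityʳ _ ⟩
  c * X (suc m)                                ∎
⊛-mono c (suc e) X zero    =
  trans (⊛-zero (mono c (suc e)) X) (trans (ℤP.*-zeroˡ (X 0)) (sym (ℤP.*-zeroʳ c)))
⊛-mono c (suc e) X (suc m) = begin
  (mono c (suc e) ⊛ X) (suc m)                     ≡⟨ ⊛-suc (mono c (suc e)) X m ⟩
  + 0 * X (suc m) + (down (mono c (suc e)) ⊛ X) m  ≡⟨ ℤP.+-identityˡ _ ⟩
  (down (mono c (suc e)) ⊛ X) m                    ≡⟨ ⊛-congˡ X down-mono m ⟩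
  (mono c e ⊛ X) m                                 ≡⟨ ⊛-mono c e X m ⟩
  c * shift e X m                                  ∎
  where
  down-mono : ∀ i → mono c (suc e) (suc i) ≡ mono c e i
  down-mono i = trans (mono-zpow c (suc e) (suc i)) (sym (mono-zpow c e i))

⊛-⊕ˡ : ∀ Q R X m → ((Q ⊕ R) ⊛ X) m ≡ (Q ⊛ X) m + (R ⊛ X) m
⊛-⊕ˡ Q R X m = dot-⊕ (coeffs X m) 0
  where
  dot-⊕ : ∀ rs i → dotQ (Q ⊕ R) rs i ≡ dotQ Q rs i + dotQ R rs i
  dot-⊕ []       i = refl
  dot-⊕ (r ∷ rs) i rewrite dot-⊕ rs (suc i) = regroup (Q i) (R i) r _ _
    where
    regroup : ∀ a b x c d → (a + b) * x + (c + d) ≡ a * x + c + (b * x + d)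
    regroup = solve-∀

⊛-⊖ˡ : ∀ Q R X m → ((Q ⊖ R) ⊛ X) m ≡ (Q ⊛ X) m - (R ⊛ X) m
⊛-⊖ˡ Q R X m = dot-⊖ (coeffs X m) 0
  where
  dot-⊖ : ∀ rs i → dotQ (Q ⊖ R) rs i ≡ dotQ Q rs i - dotQ R rs i
  dot-⊖ []       i = refl
  dot-⊖ (r ∷ rs) i rewrite dot-⊖ rs (suc i) = regroup (Q i) (R i) r _ _
    where
    regroup : ∀ a b x c d → (a - b) * x + (c - d) ≡ a * x + c - (b * x + d)
    regroup = solve-∀

⊛-⊕ʳ : ∀ Q X Y m → (Q ⊛ (X ⊕ Y)) m ≡ (Q ⊛ X) m + (Q ⊛ Y) m
⊛-⊕ʳ Q X Y zero    = begin
  (Q ⊛ (X ⊕ Y)) 0        ≡⟨ ⊛-zero Q (X ⊕ Y) ⟩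
  Q 0 * (X 0 + Y 0)      ≡⟨ ℤP.*-distribˡ-+ (Q 0) (X 0) (Y 0) ⟩
  Q 0 * X 0 + Q 0 * Y 0  ≡⟨ sym (cong₂ _+_ (⊛-zero Q X) (⊛-zero Q Y)) ⟩
  (Q ⊛ X) 0 + (Q ⊛ Y) 0  ∎
⊛-⊕ʳ Q X Y (suc m) = begin
  (Q ⊛ (X ⊕ Y)) (suc m)
    ≡⟨ ⊛-suc Q (X ⊕ Y) m ⟩
  Q 0 * (X (suc m) + Y (suc m)) + (down Q ⊛ (X ⊕ Y)) m
    ≡⟨ cong (λ t → Q 0 * (X (suc m) + Y (suc m)) + t) (⊛-⊕ʳ (down Q) X Y m) ⟩
  Q 0 * (X (suc m) + Y (suc m)) + ((down Q ⊛ X) m + (down Q ⊛ Y) m)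
    ≡⟨ regroup (Q 0) (X (suc m)) (Y (suc m)) _ _ ⟩
  (Q 0 * X (suc m) + (down Q ⊛ X) m) + (Q 0 * Y (suc m) + (down Q ⊛ Y) m)
    ≡⟨ sym (cong₂ _+_ (⊛-suc Q X m) (⊛-suc Q Y m)) ⟩
  (Q ⊛ X) (suc m) + (Q ⊛ Y) (suc m)
    ∎
  where
  regroup : ∀ a x y c d → a * (x + y) + (c + d) ≡ (a * x + c) + (a * y + d)
  regroup = solve-∀

⊛-⊖ʳ : ∀ Q X Y m → (Q ⊛ (X ⊖ Y)) m ≡ (Q ⊛ X) m - (Q ⊛ Y) m
⊛-⊖ʳ Q X Y zero    = begin
  (Q ⊛ (X ⊖ Y)) 0        ≡⟨ ⊛-zero Q (X ⊖ Y) ⟩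
  Q 0 * (X 0 - Y 0)      ≡⟨ distrib (Q 0) (X 0) (Y 0) ⟩
  Q 0 * X 0 - Q 0 * Y 0  ≡⟨ sym (cong₂ _-_ (⊛-zero Q X) (⊛-zero Q Y)) ⟩
  (Q ⊛ X) 0 - (Q ⊛ Y) 0  ∎
  where
  distrib : ∀ a x y → a * (x - y) ≡ a * x - a * y
  distrib = solve-∀
⊛-⊖ʳ Q X Y (suc m) = begin
  (Q ⊛ (X ⊖ Y)) (suc m)
    ≡⟨ ⊛-suc Q (X ⊖ Y) m ⟩
  Q 0 * (X (suc m) - Y (suc m)) + (down Q ⊛ (X ⊖ Y)) m
    ≡⟨ cong (λ t → Q 0 * (X (suc m) - Y (suc m)) + t) (⊛-⊖ʳ (down Q) X Y m) ⟩
  Q 0 * (X (suc m) - Y (suc m)) + ((down Q ⊛ X) m - (down Q ⊛ Y) m)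
    ≡⟨ regroup (Q 0) (X (suc m)) (Y (suc m)) _ _ ⟩
  (Q 0 * X (suc m) + (down Q ⊛ X) m) - (Q 0 * Y (suc m) + (down Q ⊛ Y) m)
    ≡⟨ sym (cong₂ _-_ (⊛-suc Q X m) (⊛-suc Q Y m)) ⟩
  (Q ⊛ X) (suc m) - (Q ⊛ Y) (suc m)
    ∎
  where
  regroup : ∀ a x y c d → a * (x - y) + (c - d) ≡ (a * x + c) - (a * y + d)
  regroup = solve-∀

⊛-shift₁ : ∀ Q X m → (Q ⊛ shift 1 X) m ≡ shift 1 (Q ⊛ X) m
⊛-shift₁ Q X zero          = trans (⊛-zero Q (shift 1 X)) (ℤP.*-zeroʳ (Q 0))
⊛-shift₁ Q X (suc zero)    = begin
  (Q ⊛ shift 1 X) 1                         ≡⟨ ⊛-suc Q (shift 1 X) 0 ⟩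
  Q 0 * X 0 + (down Q ⊛ shift 1 X) 0        ≡⟨ cong (λ t → Q 0 * X 0 + t) (⊛-shift₁ (down Q) X 0) ⟩
  Q 0 * X 0 + + 0                           ≡⟨ ℤP.+-identityʳ _ ⟩
  Q 0 * X 0                                 ≡⟨ sym (⊛-zero Q X) ⟩
  (Q ⊛ X) 0                                 ∎
⊛-shift₁ Q X (suc (suc m)) = begin
  (Q ⊛ shift 1 X) (suc (suc m))                     ≡⟨ ⊛-suc Q (shift 1 X) (suc m) ⟩
  Q 0 * X (suc m) + (down Q ⊛ shift 1 X) (suc m)    ≡⟨ cong (λ t → Q 0 * X (suc m) + t) (⊛-shift₁ (down Q) X (suc m)) ⟩
  Q 0 * X (suc m) + (down Q ⊛ X) m                  ≡⟨ sym (⊛-suc Q X m) ⟩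
  (Q ⊛ X) (suc m)                                   ∎

⊛-shift : ∀ Q X j m → (Q ⊛ shift j X) m ≡ shift j (Q ⊛ X) m
⊛-shift Q X zero    m = refl
⊛-shift Q X (suc j) m = begin
  (Q ⊛ shift (suc j) X) m          ≡⟨ ⊛-congʳ Q m (λ i _ → sym (shift-shift X j i)) ⟩
  (Q ⊛ shift 1 (shift j X)) m      ≡⟨ ⊛-shift₁ Q (shift j X) m ⟩
  shift 1 (Q ⊛ shift j X) m        ≡⟨ shift-cong 1 (⊛-shift Q X j) m ⟩
  shift 1 (shift j (Q ⊛ X)) m      ≡⟨ shift-shift (Q ⊛ X) j m ⟩
  shift (suc j) (Q ⊛ X) m          ∎

⊛-down : ∀ Q X m → (Q ⊛ down X) m ≡ (Q ⊛ X) (suc m) - Q (suc m) * X 0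
⊛-down Q X zero    = begin
  (Q ⊛ down X) 0                                 ≡⟨ ⊛-zero Q (down X) ⟩
  Q 0 * X 1                                      ≡⟨ undo (Q 0 * X 1) (Q 1 * X 0) ⟩
  Q 0 * X 1 + Q 1 * X 0 - Q 1 * X 0              ≡⟨ cong (λ t → Q 0 * X 1 + t - Q 1 * X 0) (sym (⊛-zero (down Q) X)) ⟩
  Q 0 * X 1 + (down Q ⊛ X) 0 - Q 1 * X 0         ≡⟨ cong (_- Q 1 * X 0) (sym (⊛-suc Q X 0)) ⟩
  (Q ⊛ X) 1 - Q 1 * X 0                          ∎
  where
  undo : ∀ a b → a ≡ a + b - b
  undo = solve-∀
⊛-down Q X (suc m) = begin
  (Q ⊛ down X) (suc m)
    ≡⟨ ⊛-suc Q (down X) m ⟩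
  Q 0 * X (suc (suc m)) + (down Q ⊛ down X) m
    ≡⟨ cong (λ t → Q 0 * X (suc (suc m)) + t) (⊛-down (down Q) X m) ⟩
  Q 0 * X (suc (suc m)) + ((down Q ⊛ X) (suc m) - Q (suc (suc m)) * X 0)
    ≡⟨ sym (ℤP.+-assoc (Q 0 * X (suc (suc m))) _ _) ⟩
  Q 0 * X (suc (suc m)) + (down Q ⊛ X) (suc m) - Q (suc (suc m)) * X 0
    ≡⟨ cong (_- Q (suc (suc m)) * X 0) (sym (⊛-suc Q X (suc m))) ⟩
  (Q ⊛ X) (suc (suc m)) - Q (suc (suc m)) * X 0
    ∎

⊛-cancel : ∀ {Q X Y} → Q 0 ≡ + 1 → ∀ M →
  (∀ m → m ≤ M → (Q ⊛ X) m ≡ (Q ⊛ Y) m) → ∀ m → m ≤ M → X m ≡ Y m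
⊛-cancel {Q} {X} {Y} Q₀≡1 M eq m m≤M = agree m m≤M m ℕP.≤-refl
  where
  cancel-unit : ∀ {x y} d → Q 0 * x + d ≡ Q 0 * y + d → x ≡ y
  cancel-unit {x} {y} d e = trans (isolate x d) (trans (cong (_- d) e₁) (sym (isolate y d)))
    where
    e₁ : + 1 * x + d ≡ + 1 * y + d
    e₁ = subst (λ q → q * x + d ≡ q * y + d) Q₀≡1 e
    isolate : ∀ x d → x ≡ + 1 * x + d - d
    isolate = solve-∀

  agree : ∀ m → m ≤ M → ∀ i → i ≤ m → X i ≡ Y i
  agree zero    0≤M zero z≤n = cancel-unit (+ 0) (eq 0 0≤M)
  agree (suc m) 1+m≤M i i≤1+m with ℕP.m≤n⇒m<n∨m≡n i≤1+m
  ... | inj₁ i<1+m = agree m (ℕP.≤-trans (ℕP.n≤1+n m) 1+m≤M) i (ℕP.≤-pred i<1+m)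
  ... | inj₂ refl = cancel-unit ((down Q ⊛ Y) m) (begin
    Q 0 * X (suc m) + (down Q ⊛ Y) m  ≡⟨ cong (λ t → Q 0 * X (suc m) + t) (sym (⊛-congʳ (down Q) m below)) ⟩
    Q 0 * X (suc m) + (down Q ⊛ X) m  ≡⟨ sym (⊛-suc Q X m) ⟩
    (Q ⊛ X) (suc m)                   ≡⟨ eq (suc m) 1+m≤M ⟩
    (Q ⊛ Y) (suc m)                   ≡⟨ ⊛-suc Q Y m ⟩
    Q 0 * Y (suc m) + (down Q ⊛ Y) m  ∎)
    where
    below : ∀ i → i ≤ m → X i ≡ Y i
    below = agree m (ℕP.≤-trans (ℕP.n≤1+n m) 1+m≤M)

divList-coeffs : ∀ P Q m → divList P Q m ≡ coeffs (P ⊘ Q) m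
divList-coeffs P Q zero    = refl
divList-coeffs P Q (suc m) =
  cong (λ rs → P (suc m) - dotQ Q (divList P Q m) 1 ∷ rs) (divList-coeffs P Q m)

⊘-solves : ∀ P Q → Q 0 ≡ + 1 → ∀ m → (Q ⊛ (P ⊘ Q)) m ≡ P m
⊘-solves P Q Q₀≡1 zero    = trans (⊛-zero Q (P ⊘ Q)) (trans (cong (_* P 0) Q₀≡1) (ℤP.*-identityˡ (P 0)))
⊘-solves P Q Q₀≡1 (suc m) = begin
  Q 0 * (P (suc m) - dotQ Q rs 1) + dotQ Q (coeffs (P ⊘ Q) m) 1
    ≡⟨ cong₂ (λ q t → q * (P (suc m) - dotQ Q rs 1) + dotQ Q t 1) Q₀≡1 (sym (divList-coeffs P Q m)) ⟩
  + 1 * (P (suc m) - dotQ Q rs 1) + dotQ Q rs 1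
    ≡⟨ cancel (P (suc m)) (dotQ Q rs 1) ⟩
  P (suc m)
    ∎
  where
  rs = divList P Q m
  cancel : ∀ p d → + 1 * (p - d) + d ≡ p
  cancel = solve-∀

⊘-unique : ∀ {P Q X} → Q 0 ≡ + 1 → ∀ M → (∀ m → m ≤ M → (Q ⊛ X) m ≡ P m) →
  ∀ m → m ≤ M → (P ⊘ Q) m ≡ X m
⊘-unique {P} {Q} Q₀≡1 M eq =
  ⊛-cancel Q₀≡1 M (λ m m≤M → trans (⊘-solves P Q Q₀≡1 m) (sym (eq m m≤M)))

numer∞ : Series
numer∞ = mono (+ 1) 0 ⊕ mono (+ 1) 2

denom∞ : Series
denom∞ = mono (+ 1) 0 ⊖ mono (+ 2) 1 ⊕ mono (+ 1) 2 ⊖ mono (+ 1) 3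

numer : ℕ → Series
numer k = mono (+ 1) 0 ⊕ mono (+ 1) 2 ⊖ mono (+ 1) (k ℕ.∸ 1) ⊕ mono (+ 1) k ⊖ mono (+ 2) (suc k)

denom : ℕ → Series
denom k = denom∞ ⊕ mono (+ 1) (suc (suc k))

mono-unit : ∀ e m → mono (+ 1) e m ≡ zpow e m
mono-unit e m = trans (mono-zpow (+ 1) e m) (ℤP.*-identityˡ (zpow e m))

numer∞-coeff : ∀ m → numer∞ m ≡ zpow 0 m + zpow 2 m
numer∞-coeff m = cong₂ _+_ (mono-unit 0 m) (mono-unit 2 m)

numer-coeff : ∀ k' m → numer (suc k') m ≡
  zpow 0 m + zpow 2 m - zpow k' m + zpow (suc k') m - + 2 * zpow (suc (suc k')) m
numer-coeff k' m =
  cong₂ _-_ (cong₂ _+_ (cong₂ _-_ (numer∞-coeff m) (mono-unit k' m)) (mono-unit (suc k') m))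
            (mono-zpow (+ 2) (suc (suc k')) m)

denom-coeff : ∀ k m → denom k m ≡
  zpow 0 m - + 2 * zpow 1 m + zpow 2 m - zpow 3 m + zpow (suc (suc k)) m
denom-coeff k m =
  cong₂ _+_ (cong₂ _-_ (cong₂ _+_ (cong₂ _-_ (mono-unit 0 m) (mono-zpow (+ 2) 1 m)) (mono-unit 2 m))
                       (mono-unit 3 m))
            (mono-unit (suc (suc k)) m)

⊛-unit : ∀ e X m → (mono (+ 1) e ⊛ X) m ≡ shift e X m
⊛-unit e X m = trans (⊛-mono (+ 1) e X m) (ℤP.*-identityˡ (shift e X m))

⊛-denom∞ : ∀ X m → (denom∞ ⊛ X) m ≡ X m - + 2 * shift 1 X m + shift 2 X m - shift 3 X m
⊛-denom∞ X m =
  trans (⊛-⊖ˡ (mono (+ 1) 0 ⊖ mono (+ 2) 1 ⊕ mono (+ 1) 2) (mono (+ 1) 3) X m)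
  (cong₂ _-_
    (trans (⊛-⊕ˡ (mono (+ 1) 0 ⊖ mono (+ 2) 1) (mono (+ 1) 2) X m)
      (cong₂ _+_ (trans (⊛-⊖ˡ (mono (+ 1) 0) (mono (+ 2) 1) X m)
                        (cong₂ _-_ (⊛-unit 0 X m) (⊛-mono (+ 2) 1 X m)))
                 (⊛-unit 2 X m)))
    (⊛-unit 3 X m))

⊛-denom : ∀ k X m → (denom k ⊛ X) m ≡ (denom∞ ⊛ X) m + shift (suc (suc k)) X m
⊛-denom k X m = trans (⊛-⊕ˡ denom∞ (mono (+ 1) (suc (suc k))) X m)
  (cong (λ t → (denom∞ ⊛ X) m + t) (⊛-unit (suc (suc k)) X m))

-- In state `free` the last letter
-- read was 0 (or nothing was read), in `single` the last letter is an
-- isolated 1, in `block` the last two letters are 1, and `dead` is reached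
-- when an isolated 1 is followed by 0.
data State : Set where
  free single block dead : State

step : State → Bool → State
step free   false = free
step free   true  = single
step single false = dead
step single true  = block
step block  false = free
step block  true  = block
step dead   _     = dead

accepting : State → Bool
accepting free   = true
accepting single = false
accepting block  = true
accepting dead   = false

bit : Bool → ℕ
bit true  = 1
bit false = 0

<ᵇ-true : ∀ {j k} → j < k → (j <ᵇ k) ≡ true
<ᵇ-true j<k = Equivalence.to T-≡ (ℕP.<⇒<ᵇ j<k)

<ᵇ-false : ∀ {j k} → k ≤ j → (j <ᵇ k) ≡ false
<ᵇ-false {j}     {zero}  _         = refl
<ᵇ-false {suc j} {suc k} (s≤s k≤j) = <ᵇ-false k≤j

-- countBelow k st c n is the number of words of length n accepted from st
-- all of whose runs of zeros are shorter than k, where the first run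
-- continues a run of c zeros already read.
countBelow : ℕ → State → ℕ → ℕ → ℕ
countBelow k st c zero    = bit (accepting st ∧ (c <ᵇ k))
countBelow k st c (suc n) =
  countBelow k (step st false) (suc c) n ℕ.+
  (if c <ᵇ k then countBelow k (step st true) 0 n else 0)

countBelow-dead : ∀ k c n → countBelow k dead c n ≡ 0
countBelow-dead k c zero    = refl
countBelow-dead k c (suc n) with c <ᵇ k
... | true  = cong₂ ℕ._+_ (countBelow-dead k (suc c) n) (countBelow-dead k 0 n)
... | false = trans (ℕP.+-identityʳ _) (countBelow-dead k (suc c) n)

countBelow-long : ∀ k j n → k ≤ j → countBelow k free j n ≡ 0
countBelow-long k j zero    k≤j rewrite <ᵇ-false k≤j = refl
countBelow-long k j (suc n) k≤j rewrite <ᵇ-false k≤j =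
  trans (ℕP.+-identityʳ _) (countBelow-long k (suc j) n (ℕP.m≤n⇒m≤1+n k≤j))

-- Generating functions of the words with all runs of zeros shorter than
-- k = k' + 1.  The transitions of the automaton give a linear system for
-- them, which we solve: denom k ⊛ fromBlock = 1 - z^k, and the words read
-- from the start satisfy denom k ⊛ down (afterZeros 0) = numer k.
module BoundedRuns (k' : ℕ) where

  k : ℕ
  k = suc k'

  -- Words accepted from `block`, and from `free` after a run of j zeros.
  fromBlock : Series
  fromBlock m = + countBelow k block 0 m

  afterZeros : ℕ → Series
  afterZeros j m = + countBelow k free j m

  -- After an isolated 1 the next letter must be 1.
  fromSingle : ∀ m → + countBelow k single 0 m ≡ shift 1 fromBlock m
  fromSingle zero    = refl
  fromSingle (suc m) = cong (λ t → + (t ℕ.+ countBelow k block 0 m)) (countBelow-dead k 1 m)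

  -- The transition equations: from `block` a 0 starts a run of zeros and a
  -- 1 stays in `block`; from `free` a 0 prolongs the run and a 1 must be
  -- followed by another 1 (fromSingle).
  fromBlock-rec : ∀ m → fromBlock m ≡ zpow 0 m + shift 1 (afterZeros 1) m + shift 1 fromBlock m
  fromBlock-rec zero    = refl
  fromBlock-rec (suc m) = trans (ℤP.pos-+ (countBelow k free 1 m) (countBelow k block 0 m))
    (cong (_+ fromBlock m) (sym (ℤP.+-identityˡ (afterZeros 1 m))))

  afterZeros-rec : ∀ j → j < k → ∀ m →
    afterZeros j m ≡ zpow 0 m + shift 1 (afterZeros (suc j)) m + shift 2 fromBlock m
  afterZeros-rec j j<k zero    rewrite <ᵇ-true j<k = refl
  afterZeros-rec j j<k (suc m) rewrite <ᵇ-true j<k = begin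
    + (countBelow k free (suc j) m ℕ.+ countBelow k single 0 m)  ≡⟨ ℤP.pos-+ _ (countBelow k single 0 m) ⟩
    afterZeros (suc j) m + + countBelow k single 0 m             ≡⟨ cong₂ _+_ (sym (ℤP.+-identityˡ (afterZeros (suc j) m))) (fromSingle m) ⟩
    + 0 + afterZeros (suc j) m + shift 1 fromBlock m             ∎

  afterZeros-long : ∀ j → k ≤ j → ∀ m → afterZeros j m ≡ + 0
  afterZeros-long j k≤j m = cong +_ (countBelow-long k j m k≤j)

  short-run : ∀ j d → j ℕ.+ suc d ≡ k → j < k
  short-run j d j+1+d≡k =
    ℕP.≤-trans (s≤s (ℕP.m≤m+n j d)) (ℕP.≤-reflexive (trans (sym (ℕP.+-suc j d)) j+1+d≡k))

  -- (1 - z) · afterZeros j = (1 - z^d) · (1 + z² · fromBlock), where d = k - j;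
  -- by induction on d, starting from afterZeros k = 0.
  afterZeros-difference : ∀ d j → j ℕ.+ d ≡ k → ∀ m →
    afterZeros j m - shift 1 (afterZeros j) m ≡
    zpow 0 m - zpow d m + shift 2 fromBlock m - shift (suc (suc d)) fromBlock m
  afterZeros-difference zero j j+0≡k m =
    trans (cong₂ _-_ (afterZeros-long j k≤j m) (shift-null 1 (afterZeros-long j k≤j) m))
          (sym (cancel (zpow 0 m) (shift 2 fromBlock m)))
    where
    k≤j : k ≤ j
    k≤j = ℕP.≤-reflexive (trans (sym j+0≡k) (ℕP.+-identityʳ j))
    cancel : ∀ a b → a - a + b - b ≡ + 0 - + 0
    cancel = solve-∀
  afterZeros-difference (suc d) j j+d≡k zero    = cong (_- + 0) (afterZeros-rec j (short-run j d j+d≡k) 0)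
  afterZeros-difference (suc d) j j+d≡k (suc m) = begin
    afterZeros j (suc m) - afterZeros j m
      ≡⟨ cong₂ _-_ (afterZeros-rec j j<k (suc m)) (afterZeros-rec j j<k m) ⟩
    (+ 0 + Z m + B₁) - (zpow 0 m + shift 1 Z m + B₂)
      ≡⟨ regroup (Z m) (shift 1 Z m) B₁ (zpow 0 m) B₂ ⟩
    (Z m - shift 1 Z m) + B₁ - zpow 0 m - B₂
      ≡⟨ cong (λ t → t + B₁ - zpow 0 m - B₂) (afterZeros-difference d (suc j) (trans (sym (ℕP.+-suc j d)) j+d≡k) m) ⟩
    (zpow 0 m - zpow d m + B₂ - shift (suc (suc d)) fromBlock m) + B₁ - zpow 0 m - B₂
      ≡⟨ simplify (zpow 0 m) (zpow d m) B₂ (shift (suc (suc d)) fromBlock m) B₁ ⟩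
    + 0 - zpow d m + B₁ - shift (suc (suc d)) fromBlock m
      ∎
    where
    j<k : j < k
    j<k = short-run j d j+d≡k
    Z : Series
    Z = afterZeros (suc j)
    B₁ B₂ : ℤ
    B₁ = shift 1 fromBlock m
    B₂ = shift 2 fromBlock m
    regroup : ∀ z z₁ b₁ e b₂ → (+ 0 + z + b₁) - (e + z₁ + b₂) ≡ (z - z₁) + b₁ - e - b₂
    regroup = solve-∀
    simplify : ∀ e δ b₂ b b₁ → (e - δ + b₂ - b) + b₁ - e - b₂ ≡ + 0 - δ + b₁ - b
    simplify = solve-∀

  -- The coefficientwise form of denom k ⊛ fromBlock = 1 - z^k, obtained by
  -- eliminating afterZeros 1 between fromBlock-rec and afterZeros-difference,
  -- each taken at degrees m and m - 1.
  fromBlock-recurrence : ∀ m →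
    fromBlock m - + 2 * shift 1 fromBlock m + shift 2 fromBlock m - shift 3 fromBlock m
      + shift (suc (suc k)) fromBlock m ≡ zpow 0 m - zpow k m
  fromBlock-recurrence m =
    eliminate (B 0) (B 1) (B 2) (B 3) (B (suc (suc k)))
      (shift 1 (afterZeros 1) m) (shift 2 (afterZeros 1) m) (zpow 0 m) (zpow 1 m) (zpow k m)
      (fromBlock-rec m) (shifted-rec m) (isolate (shifted-difference m))
    where
    B : ℕ → ℤ
    B j = shift j fromBlock m
    shifted-rec : ∀ m → shift 1 fromBlock m ≡ zpow 1 m + shift 2 (afterZeros 1) m + shift 2 fromBlock m
    shifted-rec zero    = refl
    shifted-rec (suc m) = fromBlock-rec m
    shifted-difference : ∀ m → shift 1 (afterZeros 1) m - shift 2 (afterZeros 1) m ≡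
      zpow 1 m - zpow k m + shift 3 fromBlock m - shift (suc (suc k)) fromBlock m
    shifted-difference zero    = refl
    shifted-difference (suc m) = afterZeros-difference k' 1 refl m
    isolate : ∀ {x y r} → x - y ≡ r → x ≡ y + r
    isolate {x} {y} refl = shuffle x y
      where
      shuffle : ∀ x y → x ≡ y + (x - y)
      shuffle = solve-∀
    eliminate : ∀ s s₁ s₂ s₃ sₖ z₁ z₂ e₀ e₁ eₖ →
      s ≡ e₀ + z₁ + s₁ → s₁ ≡ e₁ + z₂ + s₂ → z₁ ≡ z₂ + (e₁ - eₖ + s₃ - sₖ) →
      s - + 2 * s₁ + s₂ - s₃ + sₖ ≡ e₀ - eₖ
    eliminate _ _ s₂ s₃ sₖ _ z₂ e₀ e₁ eₖ refl refl refl = ring s₂ s₃ sₖ z₂ e₀ e₁ eₖ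
      where
      ring : ∀ s₂ s₃ sₖ z₂ e₀ e₁ eₖ →
        e₀ + (z₂ + (e₁ - eₖ + s₃ - sₖ)) + (e₁ + z₂ + s₂) - + 2 * (e₁ + z₂ + s₂) + s₂ - s₃ + sₖ ≡ e₀ - eₖ
      ring = solve-∀

  fromBlock-equation : ∀ m → (denom k ⊛ fromBlock) m ≡ zpow 0 m - zpow k m
  fromBlock-equation m = begin
    (denom k ⊛ fromBlock) m
      ≡⟨ ⊛-denom k fromBlock m ⟩
    (denom∞ ⊛ fromBlock) m + shift (suc (suc k)) fromBlock m
      ≡⟨ cong (_+ shift (suc (suc k)) fromBlock m) (⊛-denom∞ fromBlock m) ⟩
    fromBlock m - + 2 * shift 1 fromBlock m + shift 2 fromBlock m - shift 3 fromBlock m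
      + shift (suc (suc k)) fromBlock m
      ≡⟨ fromBlock-recurrence m ⟩
    zpow 0 m - zpow k m
      ∎

  smoothed : Series
  smoothed = fromBlock ⊖ shift 1 fromBlock ⊕ shift 2 fromBlock

  afterZeros-start : ∀ m → afterZeros 0 m ≡ smoothed m
  afterZeros-start = difference-injective (afterZeros 0) smoothed differences
    where
    differences : ∀ m → afterZeros 0 m - shift 1 (afterZeros 0) m ≡ smoothed m - shift 1 smoothed m
    differences m = begin
      afterZeros 0 m - shift 1 (afterZeros 0) m
        ≡⟨ afterZeros-difference k 0 refl m ⟩
      zpow 0 m - zpow k m + B 2 - B (suc (suc k))
        ≡⟨ cong (λ t → t + B 2 - B (suc (suc k))) (sym (fromBlock-recurrence m)) ⟩
      B 0 - + 2 * B 1 + B 2 - B 3 + B (suc (suc k)) + B 2 - B (suc (suc k))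
        ≡⟨ ring (B 0) (B 1) (B 2) (B 3) (B (suc (suc k))) ⟩
      (B 0 - B 1 + B 2) - (B 1 - B 2 + B 3)
        ≡⟨ cong (λ t → B 0 - B 1 + B 2 - t) (sym shifted) ⟩
      smoothed m - shift 1 smoothed m
        ∎
      where
      B : ℕ → ℤ
      B j = shift j fromBlock m
      shifted : shift 1 smoothed m ≡ B 1 - B 2 + B 3
      shifted = begin
        shift 1 smoothed m
          ≡⟨ shift-⊕ (fromBlock ⊖ shift 1 fromBlock) (shift 2 fromBlock) 1 m ⟩
        shift 1 (fromBlock ⊖ shift 1 fromBlock) m + shift 1 (shift 2 fromBlock) m
          ≡⟨ cong₂ _+_ (shift-⊖ fromBlock (shift 1 fromBlock) 1 m) (shift-shift fromBlock 2 m) ⟩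
        B 1 - shift 1 (shift 1 fromBlock) m + B 3
          ≡⟨ cong (λ t → B 1 - t + B 3) (shift-shift fromBlock 1 m) ⟩
        B 1 - B 2 + B 3
          ∎
      ring : ∀ b₀ b₁ b₂ b₃ bₖ →
        b₀ - + 2 * b₁ + b₂ - b₃ + bₖ + b₂ - bₖ ≡ (b₀ - b₁ + b₂) - (b₁ - b₂ + b₃)
      ring = solve-∀

  oneMinus : Series
  oneMinus = zpow 0 ⊖ zpow k

  smoothed-equation : ∀ m → (denom k ⊛ smoothed) m ≡ oneMinus m - shift 1 oneMinus m + shift 2 oneMinus m
  smoothed-equation m = begin
    (denom k ⊛ smoothed) m
      ≡⟨ ⊛-⊕ʳ (denom k) (fromBlock ⊖ shift 1 fromBlock) (shift 2 fromBlock) m ⟩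
    (denom k ⊛ (fromBlock ⊖ shift 1 fromBlock)) m + (denom k ⊛ shift 2 fromBlock) m
      ≡⟨ cong (_+ (denom k ⊛ shift 2 fromBlock) m) (⊛-⊖ʳ (denom k) fromBlock (shift 1 fromBlock) m) ⟩
    (denom k ⊛ fromBlock) m - (denom k ⊛ shift 1 fromBlock) m + (denom k ⊛ shift 2 fromBlock) m
      ≡⟨ cong₂ (λ a b → (denom k ⊛ fromBlock) m - a + b) (⊛-shift (denom k) fromBlock 1 m)
                                                        (⊛-shift (denom k) fromBlock 2 m) ⟩
    (denom k ⊛ fromBlock) m - shift 1 (denom k ⊛ fromBlock) m + shift 2 (denom k ⊛ fromBlock) m
      ≡⟨ cong₂ (λ a b → a - b + shift 2 (denom k ⊛ fromBlock) m) (fromBlock-equation m)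
                                                              (shift-cong 1 fromBlock-equation m) ⟩
    oneMinus m - shift 1 oneMinus m + shift 2 (denom k ⊛ fromBlock) m
      ≡⟨ cong (λ t → oneMinus m - shift 1 oneMinus m + t) (shift-cong 2 fromBlock-equation m) ⟩
    oneMinus m - shift 1 oneMinus m + shift 2 oneMinus m
      ∎

  -- down (afterZeros 0) counts the nonempty words with all runs of zeros
  -- shorter than k.  As afterZeros 0 has constant term 1, multiplying it by
  -- denom k gives ((1 - z + z²)(1 - z^k) - denom k) / z = numer k.
  bounded-equation : ∀ m → (denom k ⊛ down (afterZeros 0)) m ≡ numer k m
  bounded-equation m = begin
    (denom k ⊛ down (afterZeros 0)) m
      ≡⟨ ⊛-congʳ (denom k) m (λ i _ → afterZeros-start (suc i)) ⟩
    (denom k ⊛ down smoothed) m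
      ≡⟨ ⊛-down (denom k) smoothed m ⟩
    (denom k ⊛ smoothed) (suc m) - denom k (suc m) * + 1
      ≡⟨ cong₂ (λ a b → a - b * + 1) (smoothed-equation (suc m)) (denom-coeff k (suc m)) ⟩
    (+ 0 - zpow k' m - (zpow 0 m - zpow k m) + shift 1 oneMinus m) - D * + 1
      ≡⟨ cong (λ t → (+ 0 - zpow k' m - (zpow 0 m - zpow k m) + t) - D * + 1) shifted ⟩
    (+ 0 - zpow k' m - (zpow 0 m - zpow k m) + (zpow 1 m - zpow (suc k) m)) - D * + 1
      ≡⟨ ring (zpow 0 m) (zpow 1 m) (zpow 2 m) (zpow k' m) (zpow k m) (zpow (suc k) m) ⟩
    zpow 0 m + zpow 2 m - zpow k' m + zpow k m - + 2 * zpow (suc k) m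
      ≡⟨ sym (numer-coeff k' m) ⟩
    numer k m
      ∎
    where
    D : ℤ
    D = + 0 - + 2 * zpow 0 m + zpow 1 m - zpow 2 m + zpow (suc k) m
    shifted : shift 1 oneMinus m ≡ zpow 1 m - zpow (suc k) m
    shifted = trans (shift-⊖ (zpow 0) (zpow k) 1 m) (cong₂ _-_ (shift-zpow 1 0 m) (shift-zpow 1 k m))
    ring : ∀ e₀ e₁ e₂ a eₖ b →
      (+ 0 - a - (e₀ - eₖ) + (e₁ - b)) - (+ 0 - + 2 * e₀ + e₁ - e₂ + b) * + 1 ≡
      e₀ + e₂ - a + eₖ - + 2 * b
    ring = solve-∀

fShifted : Series
fShifted m = f (suc (suc (suc m)))

-- denom∞ ⊛ fShifted = numer∞ is the recurrence defining f.
fShifted-equation : ∀ m → (denom∞ ⊛ fShifted) m ≡ numer∞ m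
fShifted-equation zero                = refl
fShifted-equation (suc zero)          = refl
fShifted-equation (suc (suc zero))    = refl
fShifted-equation (suc (suc (suc j))) =
  trans (⊛-denom∞ fShifted (suc (suc (suc j)))) (recurrence (fShifted (suc (suc j))) (fShifted (suc j)) (fShifted j))
  where
  recurrence : ∀ a b c → (+ 2 * a - b + c) - + 2 * a + b - c ≡ + 0 + + 0
  recurrence = solve-∀

Afun-coeff : ∀ m → Afun m ≡ fShifted m
Afun-coeff m = ⊘-unique refl m (λ i _ → fShifted-equation i) m ℕP.≤-refl

Bfun-coeff : ∀ k' m → Bfun (suc k') m ≡ + countBelow (suc k') free 0 (suc m)
Bfun-coeff k' m = ⊘-unique refl m (λ i _ → BoundedRuns.bounded-equation k' i) m ℕP.≤-refl

numer-low : ∀ k' m → m < k' → numer (suc k') m ≡ numer∞ m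
numer-low k' m m<k' = begin
  numer (suc k') m
    ≡⟨ numer-coeff k' m ⟩
  zpow 0 m + zpow 2 m - zpow k' m + zpow (suc k') m - + 2 * zpow (suc (suc k')) m
    ≡⟨ cong₂ (λ a b → zpow 0 m + zpow 2 m - a + b - + 2 * zpow (suc (suc k')) m)
             (zpow-below k' m m<k') (zpow-below (suc k') m (ℕP.m≤n⇒m≤1+n m<k')) ⟩
  zpow 0 m + zpow 2 m - + 0 + + 0 - + 2 * zpow (suc (suc k')) m
    ≡⟨ cong (λ a → zpow 0 m + zpow 2 m - + 0 + + 0 - + 2 * a)
            (zpow-below (suc (suc k')) m (ℕP.m≤n⇒m≤1+n (ℕP.m≤n⇒m≤1+n m<k'))) ⟩
  zpow 0 m + zpow 2 m - + 0 + + 0 - + 2 * + 0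
    ≡⟨ drop-zeros (zpow 0 m) (zpow 2 m) ⟩
  zpow 0 m + zpow 2 m
    ≡⟨ sym (numer∞-coeff m) ⟩
  numer∞ m
    ∎
  where
  drop-zeros : ∀ a b → a + b - + 0 + + 0 - + 2 * + 0 ≡ a + b
  drop-zeros = solve-∀

-- For k = n' + 2 the equations of Afun and Bfun k agree up to degree n', so
-- f (n' + 3) counts the words of length n' + 1 with runs of zeros shorter
-- than n' + 2.
f-count : ∀ n' → fShifted n' ≡ + countBelow (suc (suc n')) free 0 (suc n')
f-count n' = sym (⊛-cancel refl n' agree n' ℕP.≤-refl)
  where
  open BoundedRuns (suc n') using (k; afterZeros; bounded-equation)
  agree : ∀ i → i ≤ n' → (denom k ⊛ down (afterZeros 0)) i ≡ (denom k ⊛ fShifted) i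
  agree i i≤n' = begin
    (denom k ⊛ down (afterZeros 0)) i             ≡⟨ bounded-equation i ⟩
    numer k i                                     ≡⟨ numer-low (suc n') i (s≤s i≤n') ⟩
    numer∞ i                                      ≡⟨ sym (fShifted-equation i) ⟩
    (denom∞ ⊛ fShifted) i                         ≡⟨ sym (ℤP.+-identityʳ _) ⟩
    (denom∞ ⊛ fShifted) i + + 0                   ≡⟨ cong (λ t → (denom∞ ⊛ fShifted) i + t)
                                                          (sym (shift-below fShifted (suc (suc k)) i i<k+2)) ⟩
    (denom∞ ⊛ fShifted) i + shift (suc (suc k)) fShifted i ≡⟨ sym (⊛-denom k fShifted i) ⟩
    (denom k ⊛ fShifted) i                        ∎
    where
    i<k+2 : i < suc (suc k)
    i<k+2 = ℕP.≤-trans (s≤s i≤n') (ℕP.m≤n+m (suc n') 3)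

accepts : ∀ {n} → State → Vec Bool n → Bool
accepts st []      = accepting st
accepts st (b ∷ v) = accepts (step st b) v

accepts-dead : ∀ {n} (v : Vec Bool n) → accepts dead v ≡ false
accepts-dead []      = refl
accepts-dead (b ∷ v) = accepts-dead v

OneNear : ∀ {n} → Vec Bool n → Fin n → Set
OneNear v i = ∃[ j ] (Adjacent i j × lookup v j ≡ true)

StartsWithOne : ∀ {n} → Vec Bool n → Set
StartsWithOne []      = ⊥
StartsWithOne (b ∷ _) = b ≡ true

-- OneNear, when the letter p is imagined to the left of position 0.
OneNearAfter : ∀ {n} → Bool → Vec Bool n → Fin n → Set
OneNearAfter p (b ∷ v) fzero    = p ≡ true ⊎ StartsWithOne v
OneNearAfter p (b ∷ v) (fsuc i) = OneNearAfter b v i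

oneNear-tail⇒ : ∀ {n} b (w : Vec Bool n) i → OneNear (b ∷ w) (fsuc i) → OneNearAfter b w i
oneNear-tail⇒ b (c ∷ w)     fzero    (fzero , inj₂ refl , e)                = inj₁ e
oneNear-tail⇒ b (c ∷ d ∷ w) fzero    (fsuc (fsuc fzero) , inj₁ refl , e)    = inj₂ e
oneNear-tail⇒ b (c ∷ w)     (fsuc i) (fsuc j , inj₁ i+2≡j+1 , e) =
  oneNear-tail⇒ c w i (j , inj₁ (ℕP.suc-injective i+2≡j+1) , e)
oneNear-tail⇒ b (c ∷ w)     (fsuc i) (fsuc j , inj₂ j+1≡i+2 , e) =
  oneNear-tail⇒ c w i (j , inj₂ (ℕP.suc-injective j+1≡i+2) , e)
oneNear-tail⇒ b (c ∷ w)     fzero    (fsuc fzero , inj₁ () , _)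
oneNear-tail⇒ b (c ∷ w)     fzero    (fsuc fzero , inj₂ () , _)
oneNear-tail⇒ b (c ∷ d ∷ w) fzero    (fsuc (fsuc fzero) , inj₂ () , _)
oneNear-tail⇒ b (c ∷ d ∷ w) fzero    (fsuc (fsuc (fsuc j)) , inj₁ () , _)
oneNear-tail⇒ b (c ∷ d ∷ w) fzero    (fsuc (fsuc (fsuc j)) , inj₂ () , _)
oneNear-tail⇒ b (c ∷ w)     (fsuc i) (fzero , inj₁ () , _)
oneNear-tail⇒ b (c ∷ w)     (fsuc i) (fzero , inj₂ () , _)

oneNear-tail⇐ : ∀ {n} b (w : Vec Bool n) i → OneNearAfter b w i → OneNear (b ∷ w) (fsuc i)
oneNear-tail⇐ b (c ∷ w)     fzero    (inj₁ e) = fzero , inj₂ refl , e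
oneNear-tail⇐ b (c ∷ d ∷ w) fzero    (inj₂ e) = fsuc (fsuc fzero) , inj₁ refl , e
oneNear-tail⇐ b (c ∷ w)     (fsuc i) h with oneNear-tail⇐ c w i h
... | j , inj₁ i+1≡j , e = fsuc j , inj₁ (cong suc i+1≡j) , e
... | j , inj₂ j+1≡i , e = fsuc j , inj₂ (cong suc j+1≡i) , e

oneNear⇒ : ∀ {n} (v : Vec Bool n) i → OneNear v i → OneNearAfter false v i
oneNear⇒ (b ∷ c ∷ w) fzero    (fsuc fzero , _ , e) = inj₂ e
oneNear⇒ (b ∷ w)     (fsuc i) h                    = oneNear-tail⇒ b w i h
oneNear⇒ (b ∷ w)     fzero    (fzero , inj₁ () , _)
oneNear⇒ (b ∷ w)     fzero    (fzero , inj₂ () , _)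
oneNear⇒ (b ∷ c ∷ w) fzero    (fsuc (fsuc j) , inj₁ () , _)
oneNear⇒ (b ∷ c ∷ w) fzero    (fsuc (fsuc j) , inj₂ () , _)

oneNear⇐ : ∀ {n} (v : Vec Bool n) i → OneNearAfter false v i → OneNear v i
oneNear⇐ (b ∷ c ∷ w) fzero    (inj₂ e) = fsuc fzero , inj₁ refl , e
oneNear⇐ (b ∷ w)     (fsuc i) h        = oneNear-tail⇐ b w i h
oneNear⇐ (b ∷ w)     fzero    (inj₁ ())

MultusAfter : ∀ {n} → Bool → Vec Bool n → Set
MultusAfter {n} p v = (i : Fin n) → lookup v i ≡ true → OneNearAfter p v i

multusAfter-cons : ∀ {n} p b (w : Vec Bool n) →
  (b ≡ true → p ≡ true ⊎ StartsWithOne w) → MultusAfter b w → MultusAfter p (b ∷ w)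
multusAfter-cons p b w first rest fzero    = first
multusAfter-cons p b w first rest (fsuc i) = rest i

multusAfter-tail : ∀ {n} p b (w : Vec Bool n) → MultusAfter p (b ∷ w) → MultusAfter b w
multusAfter-tail p b w h i = h (fsuc i)

-- The states of the automaton are characterised by: free ↔ MultusAfter
-- false, block ↔ MultusAfter true, single ↔ starts with 1 and MultusAfter true.
free-sound   : ∀ {n} (v : Vec Bool n) → accepts free v ≡ true → MultusAfter false v
block-sound  : ∀ {n} (v : Vec Bool n) → accepts block v ≡ true → MultusAfter true v
single-sound : ∀ {n} (v : Vec Bool n) → accepts single v ≡ true → StartsWithOne v × MultusAfter true v
free-sound [] _ ()
free-sound (false ∷ w) acc = multusAfter-cons false false w (λ ()) (free-sound w acc)
free-sound (true ∷ w)  acc with single-sound w acc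
... | starts , rest = multusAfter-cons false true w (λ _ → inj₂ starts) rest
block-sound [] _ ()
block-sound (false ∷ w) acc = multusAfter-cons true false w (λ ()) (free-sound w acc)
block-sound (true ∷ w)  acc = multusAfter-cons true true w (λ _ → inj₁ refl) (block-sound w acc)
single-sound (false ∷ w) acc with () ← trans (sym acc) (accepts-dead w)
single-sound (true ∷ w)  acc = refl , multusAfter-cons true true w (λ _ → inj₁ refl) (block-sound w acc)

free-complete   : ∀ {n} (v : Vec Bool n) → MultusAfter false v → accepts free v ≡ true
block-complete  : ∀ {n} (v : Vec Bool n) → MultusAfter true v → accepts block v ≡ true
single-complete : ∀ {n} (v : Vec Bool n) → StartsWithOne v → MultusAfter true v → accepts single v ≡ true
free-complete [] _ = refl
free-complete (false ∷ w) m = free-complete w (multusAfter-tail false false w m)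
free-complete (true ∷ w)  m with m fzero refl
... | inj₂ starts = single-complete w starts (multusAfter-tail false true w m)
block-complete [] _ = refl
block-complete (false ∷ w) m = free-complete w (multusAfter-tail true false w m)
block-complete (true ∷ w)  m = block-complete w (multusAfter-tail true true w m)
single-complete (true ∷ w) refl m = block-complete w (multusAfter-tail true true w m)

multus⇒accepted : ∀ {n} (v : Vec Bool n) → Multus v → accepts free v ≡ true
multus⇒accepted v m = free-complete v (λ i e → oneNear⇒ v i (m i e))

accepted⇒multus : ∀ {n} (v : Vec Bool n) → accepts free v ≡ true → Multus v
accepted⇒multus v acc i e = oneNear⇐ v i (free-sound v acc i e)

sumAll : ∀ n → (Vec Bool n → ℕ) → ℕ
sumAll zero    F = F []
sumAll (suc n) F = sumAll n (λ v → F (false ∷ v)) ℕ.+ sumAll n (λ v → F (true ∷ v))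

sumAll-cong : ∀ n {F G} → (∀ v → F v ≡ G v) → sumAll n F ≡ sumAll n G
sumAll-cong zero    eq = eq []
sumAll-cong (suc n) eq = cong₂ ℕ._+_ (sumAll-cong n (λ v → eq (false ∷ v))) (sumAll-cong n (λ v → eq (true ∷ v)))

sumAll-+ : ∀ n F G → sumAll n (λ v → F v ℕ.+ G v) ≡ sumAll n F ℕ.+ sumAll n G
sumAll-+ zero    F G = refl
sumAll-+ (suc n) F G =
  trans (cong₂ ℕ._+_ (sumAll-+ n (λ v → F (false ∷ v)) (λ v → G (false ∷ v)))
                     (sumAll-+ n (λ v → F (true ∷ v)) (λ v → G (true ∷ v))))
        (+-interchange (sumAll n (λ v → F (false ∷ v))) (sumAll n (λ v → G (false ∷ v)))
                       (sumAll n (λ v → F (true ∷ v))) (sumAll n (λ v → G (true ∷ v))))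

sumAll-zero : ∀ n → sumAll n (λ _ → 0) ≡ 0
sumAll-zero zero    = refl
sumAll-zero (suc n) rewrite sumAll-zero n = refl

_==_ : ∀ {n} → Vec Bool n → Vec Bool n → Bool
[]          == []          = true
(false ∷ v) == (false ∷ w) = v == w
(true ∷ v)  == (true ∷ w)  = v == w
(false ∷ v) == (true ∷ w)  = false
(true ∷ v)  == (false ∷ w) = false

==-refl : ∀ {n} (v : Vec Bool n) → (v == v) ≡ true
==-refl []          = refl
==-refl (false ∷ v) = ==-refl v
==-refl (true ∷ v)  = ==-refl v

==-sound : ∀ {n} (v w : Vec Bool n) → (v == w) ≡ true → v ≡ w
==-sound []          []          _  = refl
==-sound (false ∷ v) (false ∷ w) eq = cong (false ∷_) (==-sound v w eq)
==-sound (true ∷ v)  (true ∷ w)  eq = cong (true ∷_) (==-sound v w eq)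

==-distinct : ∀ {n} (v w : Vec Bool n) → v ≢ w → (v == w) ≡ false
==-distinct v w v≢w with v == w in eq
... | true  = ⊥-elim (v≢w (==-sound v w eq))
... | false = refl

sumAll-point : ∀ n (v : Vec Bool n) G → sumAll n (λ w → bit (v == w) ℕ.* G w) ≡ G v
sumAll-point zero    []          G = ℕP.+-identityʳ (G [])
sumAll-point (suc n) (false ∷ v) G =
  trans (cong₂ ℕ._+_ (sumAll-point n v (λ w → G (false ∷ w))) (sumAll-zero n)) (ℕP.+-identityʳ _)
sumAll-point (suc n) (true ∷ v)  G =
  trans (cong (ℕ._+ sumAll n (λ w → bit (v == w) ℕ.* G (true ∷ w))) (sumAll-zero n))
        (sumAll-point n v (λ w → G (true ∷ w)))

multiplicity : ∀ {n} → Vec Bool n → List (Vec Bool n) → ℕ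
multiplicity w []      = 0
multiplicity w (v ∷ L) = bit (v == w) ℕ.+ multiplicity w L

sum-by-multiplicity : ∀ n (L : List (Vec Bool n)) G →
  sum (map G L) ≡ sumAll n (λ w → multiplicity w L ℕ.* G w)
sum-by-multiplicity n []      G = sym (sumAll-zero n)
sum-by-multiplicity n (v ∷ L) G = begin
  G v ℕ.+ sum (map G L)
    ≡⟨ cong₂ ℕ._+_ (sym (sumAll-point n v G)) (sum-by-multiplicity n L G) ⟩
  sumAll n (λ w → bit (v == w) ℕ.* G w) ℕ.+ sumAll n (λ w → multiplicity w L ℕ.* G w)
    ≡⟨ sym (sumAll-+ n _ _) ⟩
  sumAll n (λ w → bit (v == w) ℕ.* G w ℕ.+ multiplicity w L ℕ.* G w)
    ≡⟨ sumAll-cong n (λ w → sym (ℕP.*-distribʳ-+ (G w) (bit (v == w)) (multiplicity w L))) ⟩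
  sumAll n (λ w → multiplicity w (v ∷ L) ℕ.* G w)
    ∎

multiplicity-absent : ∀ {n} (w : Vec Bool n) L → w ∉ L → multiplicity w L ≡ 0
multiplicity-absent w []      _   = refl
multiplicity-absent w (v ∷ L) w∉L
  rewrite ==-distinct v w (λ v≡w → w∉L (here (sym v≡w))) = multiplicity-absent w L (w∉L ∘ there)

multiplicity-unique : ∀ {n} (w : Vec Bool n) L → Unique L → w ∈ L → multiplicity w L ≡ 1
multiplicity-unique w (v ∷ L) (v∉L ∷ _) (here refl) rewrite ==-refl w =
  cong suc (multiplicity-absent w L (λ w∈L → All.lookup v∉L w∈L refl))
multiplicity-unique w (v ∷ L) (v∉L ∷ unique) (there w∈L)
  rewrite ==-distinct v w (λ v≡w → All.lookup v∉L w∈L v≡w) = multiplicity-unique w L unique w∈L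

isMultus : ∀ {n} → Vec Bool n → ℕ
isMultus v = bit (accepts free v)

multiplicity-multus : ∀ {n} (L : List (Vec Bool n)) → Unique L →
  ((v : Vec Bool n) → (v ∈ L) ⇔ Multus v) → ∀ w → multiplicity w L ≡ isMultus w
multiplicity-multus L unique members w with accepts free w in acc
... | true  = multiplicity-unique w L unique (Equivalence.from (members w) (accepted⇒multus w acc))
... | false = multiplicity-absent w L λ w∈L →
  true≢false (trans (sym (multus⇒accepted w (Equivalence.to (members w) w∈L))) acc)
  where
  true≢false : true ≢ false
  true≢false ()

sum-over-multus : ∀ n (L : List (Vec Bool n)) → Unique L →
  ((v : Vec Bool n) → (v ∈ L) ⇔ Multus v) → ∀ G → sum (map G L) ≡ sumAll n (λ w → isMultus w ℕ.* G w)
sum-over-multus n L unique members G =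
  trans (sum-by-multiplicity n L G) (sumAll-cong n (λ w → cong (ℕ._* G w) (multiplicity-multus L unique members w)))

allRunsBelow : ℕ → ℕ → List Bool → Bool
allRunsBelow k c []           = c <ᵇ k
allRunsBelow k c (false ∷ bs) = allRunsBelow k (suc c) bs
allRunsBelow k c (true ∷ bs)  = (c <ᵇ k) ∧ allRunsBelow k 0 bs

⊔-<ᵇ : ∀ a b k → ((a ⊔ b) <ᵇ k) ≡ (a <ᵇ k) ∧ (b <ᵇ k)
⊔-<ᵇ zero    b       zero    = refl
⊔-<ᵇ zero    b       (suc k) = refl
⊔-<ᵇ (suc a) zero    zero    = refl
⊔-<ᵇ (suc a) zero    (suc k) = sym (∧-identityʳ _)
⊔-<ᵇ (suc a) (suc b) zero    = refl
⊔-<ᵇ (suc a) (suc b) (suc k) = ⊔-<ᵇ a b k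

longestRun-<ᵇ : ∀ k c best bs →
  (longestZeroRunAux c best bs <ᵇ k) ≡ (best <ᵇ k) ∧ allRunsBelow k c bs
longestRun-<ᵇ k c best []           = ⊔-<ᵇ best c k
longestRun-<ᵇ k c best (false ∷ bs) = longestRun-<ᵇ k (suc c) best bs
longestRun-<ᵇ k c best (true ∷ bs)  = begin
  (longestZeroRunAux 0 (best ⊔ c) bs <ᵇ k)                ≡⟨ longestRun-<ᵇ k 0 (best ⊔ c) bs ⟩
  ((best ⊔ c) <ᵇ k) ∧ allRunsBelow k 0 bs                 ≡⟨ cong (_∧ allRunsBelow k 0 bs) (⊔-<ᵇ best c k) ⟩
  ((best <ᵇ k) ∧ (c <ᵇ k)) ∧ allRunsBelow k 0 bs          ≡⟨ ∧-assoc (best <ᵇ k) (c <ᵇ k) _ ⟩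
  (best <ᵇ k) ∧ ((c <ᵇ k) ∧ allRunsBelow k 0 bs)          ∎

R₀-<ᵇ : ∀ {n} k (v : Vec Bool n) → (R₀ v <ᵇ suc k) ≡ allRunsBelow (suc k) 0 (toList v)
R₀-<ᵇ k v = longestRun-<ᵇ (suc k) 0 0 (toList v)

longestRun-≤ : ∀ M c best bs → best ≤ M → c ℕ.+ length bs ≤ M → longestZeroRunAux c best bs ≤ M
longestRun-≤ M c best []           best≤M c≤M = ℕP.⊔-lub best≤M (ℕP.≤-trans (ℕP.m≤m+n c 0) c≤M)
longestRun-≤ M c best (false ∷ bs) best≤M c≤M =
  longestRun-≤ M (suc c) best bs best≤M (ℕP.≤-trans (ℕP.≤-reflexive (sym (ℕP.+-suc c (length bs)))) c≤M)
longestRun-≤ M c best (true ∷ bs)  best≤M c≤M = longestRun-≤ M 0 (best ⊔ c) bs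
  (ℕP.⊔-lub best≤M (ℕP.≤-trans (ℕP.m≤m+n c _) c≤M))
  (ℕP.≤-trans (ℕP.n≤1+n _) (ℕP.≤-trans (ℕP.m≤n+m (suc (length bs)) c) c≤M))

R₀-≤ : ∀ {n} (v : Vec Bool n) → R₀ v ≤ n
R₀-≤ {n} v = longestRun-≤ n 0 0 (toList v) z≤n (ℕP.≤-reflexive (Vec.length-toList v))

countBelow-sum : ∀ k st c n →
  sumAll n (λ v → bit (accepts st v ∧ allRunsBelow k c (toList v))) ≡ countBelow k st c n
countBelow-sum k st c zero    = refl
countBelow-sum k st c (suc n) with c <ᵇ k
... | true  = cong₂ ℕ._+_ (countBelow-sum k (step st false) (suc c) n) (countBelow-sum k (step st true) 0 n)
... | false = cong₂ ℕ._+_ (countBelow-sum k (step st false) (suc c) n)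
  (trans (sumAll-cong n (λ v → cong bit (∧-zeroʳ (accepts (step st true) v)))) (sumAll-zero n))

multusCount : ℕ → ℕ
multusCount n = sumAll n isMultus

shortRuns : ℕ → ℕ → ℕ
shortRuns n k = sumAll n (λ v → bit (accepts free v ∧ (R₀ v <ᵇ k)))

countBelow-shortRuns : ∀ n k' → countBelow (suc k') free 0 n ≡ shortRuns n (suc k')
countBelow-shortRuns n k' = sym (trans
  (sumAll-cong n (λ v → cong (λ t → bit (accepts free v ∧ t)) (R₀-<ᵇ k' v)))
  (countBelow-sum (suc k') free 0 n))

-- The coefficients of f, Afun and Bfun k as counts of multus words: with
-- k = n' + 2 no word of length n' + 1 violates the bound on runs.
fShifted-multus : ∀ n' → fShifted n' ≡ + multusCount (suc n')
fShifted-multus n' = begin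
  fShifted n'                                              ≡⟨ f-count n' ⟩
  + countBelow (suc (suc n')) free 0 (suc n')              ≡⟨ cong +_ (countBelow-shortRuns (suc n') (suc n')) ⟩
  + shortRuns (suc n') (suc (suc n'))                      ≡⟨ cong +_ (sumAll-cong (suc n') all-short) ⟩
  + multusCount (suc n')                                   ∎
  where
  all-short : ∀ v → bit (accepts free v ∧ (R₀ v <ᵇ suc (suc n'))) ≡ isMultus v
  all-short v = trans (cong (λ t → bit (accepts free v ∧ t)) (<ᵇ-true (s≤s (R₀-≤ v))))
                      (cong bit (∧-identityʳ (accepts free v)))

f-multus : ∀ n → f (n ℕ.+ 2) ≡ + multusCount n
f-multus zero     = refl
f-multus (suc n') = trans (cong f (ℕP.+-comm (suc n') 2)) (fShifted-multus n')

Afun-multus : ∀ n' → Afun n' ≡ + multusCount (suc n')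
Afun-multus n' = trans (Afun-coeff n') (fShifted-multus n')

Bfun-shortRuns : ∀ k' n' → Bfun (suc k') n' ≡ + shortRuns (suc n') (suc k')
Bfun-shortRuns k' n' = trans (Bfun-coeff k' n') (cong +_ (countBelow-shortRuns (suc n') k'))

⊓-step : ∀ R N → R ⊓ N ℕ.+ 1 ≡ R ⊓ suc N ℕ.+ bit (R <ᵇ suc N)
⊓-step zero    N       = refl
⊓-step (suc R) zero    = cong (λ t → suc (t ℕ.+ 0)) (sym (ℕP.⊓-zeroʳ R))
⊓-step (suc R) (suc N) = cong suc (⊓-step R N)

-- Σ_{multus w} min(R₀ w, N): the N-th partial sum of the theorem.
cappedTotal : ℕ → ℕ → ℕ
cappedTotal n N = sumAll n (λ w → isMultus w ℕ.* (R₀ w ⊓ N))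

cappedTotal-step : ∀ n N → cappedTotal n N ℕ.+ multusCount n ≡ cappedTotal n (suc N) ℕ.+ shortRuns n (suc N)
cappedTotal-step n N = begin
  cappedTotal n N ℕ.+ multusCount n
    ≡⟨ sym (sumAll-+ n _ _) ⟩
  sumAll n (λ w → isMultus w ℕ.* (R₀ w ⊓ N) ℕ.+ isMultus w)
    ≡⟨ sumAll-cong n (λ w → pointwise (accepts free w) (R₀ w)) ⟩
  sumAll n (λ w → isMultus w ℕ.* (R₀ w ⊓ suc N) ℕ.+ bit (accepts free w ∧ (R₀ w <ᵇ suc N)))
    ≡⟨ sumAll-+ n _ _ ⟩
  cappedTotal n (suc N) ℕ.+ shortRuns n (suc N)
    ∎
  where
  pointwise : ∀ a R → bit a ℕ.* (R ⊓ N) ℕ.+ bit a ≡ bit a ℕ.* (R ⊓ suc N) ℕ.+ bit (a ∧ (R <ᵇ suc N))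
  pointwise false R = refl
  pointwise true  R = begin
    R ⊓ N ℕ.+ 0 ℕ.+ 1             ≡⟨ cong (ℕ._+ 1) (ℕP.+-identityʳ (R ⊓ N)) ⟩
    R ⊓ N ℕ.+ 1                   ≡⟨ ⊓-step R N ⟩
    R ⊓ suc N ℕ.+ bit (R <ᵇ suc N) ≡⟨ cong (ℕ._+ bit (R <ᵇ suc N)) (sym (ℕP.+-identityʳ (R ⊓ suc N))) ⟩
    R ⊓ suc N ℕ.+ 0 ℕ.+ bit (R <ᵇ suc N) ∎

partialSum-capped : ∀ n' N → partialSum N (suc n') ≡ + cappedTotal (suc n') N
partialSum-capped n' zero    = sym (cong +_ (trans
  (sumAll-cong (suc n') (λ w → trans (cong (isMultus w ℕ.*_) (ℕP.⊓-zeroʳ (R₀ w))) (ℕP.*-zeroʳ (isMultus w))))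
  (sumAll-zero (suc n'))))
partialSum-capped n' (suc N) = begin
  partialSum N (suc n') + (Afun n' - Bfun (suc N) n')
    ≡⟨ cong₂ (λ a b → a + (b - Bfun (suc N) n')) (partialSum-capped n' N) (Afun-multus n') ⟩
  + cappedTotal (suc n') N + (+ multusCount (suc n') - Bfun (suc N) n')
    ≡⟨ cong (λ b → + cappedTotal (suc n') N + (+ multusCount (suc n') - b)) (Bfun-shortRuns N n') ⟩
  + cappedTotal (suc n') N + (+ multusCount (suc n') - + shortRuns (suc n') (suc N))
    ≡⟨ lift-step (cappedTotal-step (suc n') N) ⟩
  + cappedTotal (suc n') (suc N)
    ∎
  where
  lift-step : ∀ {a t c h} → a ℕ.+ t ≡ c ℕ.+ h → + a + (+ t - + h) ≡ + c
  lift-step {a} {t} {c} {h} eq = begin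
    + a + (+ t - + h)   ≡⟨ reassoc (+ a) (+ t) (+ h) ⟩
    + a + + t - + h     ≡⟨ cong (_- + h) (trans (sym (ℤP.pos-+ a t)) (trans (cong +_ eq) (ℤP.pos-+ c h))) ⟩
    + c + + h - + h     ≡⟨ cancel (+ c) (+ h) ⟩
    + c                 ∎
    where
    reassoc : ∀ a t h → a + (t - h) ≡ a + t - h
    reassoc = solve-∀
    cancel : ∀ c h → c + h - h ≡ c
    cancel = solve-∀

partialSum-total : ∀ n N → n ≤ N → partialSum N n ≡ + sumAll n (λ w → isMultus w ℕ.* R₀ w)
partialSum-total zero     N _   = at-zero N
  where
  at-zero : ∀ N → partialSum N 0 ≡ + 0
  at-zero zero    = refl
  at-zero (suc N) = trans (ℤP.+-identityʳ _) (at-zero N)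
partialSum-total (suc n') N n≤N = trans (partialSum-capped n' N)
  (cong +_ (sumAll-cong (suc n') (λ w → cong (isMultus w ℕ.*_) (ℕP.m≤n⇒m⊓n≡m (ℕP.≤-trans (R₀-≤ w) n≤N)))))

length-multus : ∀ n (L : List (Vec Bool n)) → Unique L →
  ((v : Vec Bool n) → (v ∈ L) ⇔ Multus v) → length L ≡ multusCount n
length-multus n L unique members = begin
  length L                                  ≡⟨ length-as-sum L ⟩
  sum (map (λ _ → 1) L)                     ≡⟨ sum-over-multus n L unique members (λ _ → 1) ⟩
  sumAll n (λ w → isMultus w ℕ.* 1)          ≡⟨ sumAll-cong n (λ w → ℕP.*-identityʳ (isMultus w)) ⟩
  multusCount n                             ∎
  where
  length-as-sum : ∀ {A : Set} (xs : List A) → length xs ≡ sum (map (λ _ → 1) xs)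
  length-as-sum []       = refl
  length-as-sum (x ∷ xs) = cong suc (length-as-sum xs)

mainTheorem5 : (n : ℕ) (L : List (Vec Bool n)) → Unique L →
    ((v : Vec Bool n) → (v ∈ L) ⇔ Multus v) →
    ∃[ K ] ((N : ℕ) → K ≤ N →
    expectR₀ L ≡ partialSum N n ÷ℤ f (n ℕ.+ 2))
mainTheorem5 n L unique members = n , λ N n≤N → begin
  expectR₀ L
    ≡⟨⟩
  (+ sum (map R₀ L)) ÷ℤ (+ length L)
    ≡⟨ cong₂ (λ a b → (+ a) ÷ℤ (+ b)) (sum-over-multus n L unique members R₀) (length-multus n L unique members) ⟩
  (+ sumAll n (λ w → isMultus w ℕ.* R₀ w)) ÷ℤ (+ multusCount n)
    ≡⟨ cong₂ _÷ℤ_ (sym (partialSum-total n N n≤N)) (sym (f-multus n)) ⟩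
  partialSum N n ÷ℤ f (n ℕ.+ 2)
    ∎
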